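{- Let $k_1 \le k$ be positive integers and let $d \ge 2$ be an integer. Let $\delta = \frac{97}{420}$ and $\phi = 1.86 - \frac{1}{2100}$. Let $\beta(k) = 0$ for $k = 0, \dots, 8$ and $\beta(k) = \frac{1}{3} - \delta$ for $k \ge 9$. Then \[ -(k-1)\delta + \sum_{j=1}^{k-1}\left(\frac{2}{d+j} - \frac{1}{d}\right) + H_{k+1} \le \phi - \beta(k). \]
   Context: For a nonnegative integer $n$, $H_n = \sum_{i=1}^{n} \frac{1}{i}$ denotes the $n$-th harmonic number (with $H_0 = 0$). Empty sums are $0$. -}

module Defs where

open import Data.Nat as ℕ using (ℕ; zero; suc; _∸_)
open import Data.Bool using (if_then_else_)
open import Data.Integer using (+_)
open import Data.Rational using (ℚ; _/_; 0ℚ; _+_; _-_; _*_)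

ℕtoℚ : ℕ → ℚ
ℕtoℚ n = + n / 1

-- 1/n as a rational; only ever applied to n ≥ 1 below (value at 0 is a dummy 0)
inv : ℕ → ℚ
inv zero    = 0ℚ
inv (suc n) = + 1 / suc n

H : ℕ → ℚ
H zero    = 0ℚ
H (suc n) = H n + inv (suc n)

sum1to : ℕ → (ℕ → ℚ) → ℚ
sum1to zero    f = 0ℚ
sum1to (suc n) f = sum1to n f + f (suc n)

δ : ℚ
δ = + 97 / 420

φ : ℚ
φ = (+ 186 / 100) - (+ 1 / 2100)

β : ℕ → ℚ
β k = if k ℕ.<ᵇ 9 then 0ℚ else ((+ 1 / 3) - δ)

lhs : ℕ → ℕ → ℚ
lhs d k = ((0ℚ - (ℕtoℚ (k ∸ 1) * δ))
          + sum1to (k ∸ 1) (λ j → (ℕtoℚ 2 * inv (d ℕ.+ j)) - inv d))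
          + H (suc k)

-- For k ≤ 11 the claim is a finite computation once the summands are
-- controlled uniformly in d: for d ≥ 12 every summand 2/(d+j) − 1/d is at most
-- 1/d ≤ 1/12, and the remaining degrees 2 ≤ d ≤ 11 are checked exactly.
-- Beyond k = 11 the left-hand side decreases in k, because passing from k to
-- k + 1 adds 2/(d+k) − 1/d + 1/(k+2) − δ ≤ 3/13 − δ < 0; and β is constant
-- from k = 9 on.
module Submission where

open import Defs
open import Data.Nat using (ℕ; _≤_)
open import Data.Rational using () renaming (_≤_ to _≤ℚ_; _-_ to _-ℚ_)

open import Data.Nat as ℕ using (zero; suc; _∸_; _<_; s≤s; z≤n)
import Data.Nat.Properties as ℕ
open import Data.Nat.Coprimality using (1-coprimeTo) renaming (sym to coprime-sym)
open import Data.Integer as ℤ using (+_; +≤+)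
import Data.Integer.Properties as ℤ
open import Data.Integer.Tactic.RingSolver using (solve-∀)
open import Data.Rational using (ℚ; mkℚ; 0ℚ; 1ℚ; _+_; _*_; -_; *≤*; toℚᵘ)
open import Data.Rational.Properties
  using (normalize-coprime; toℚᵘ-injective; toℚᵘ-homo-+; _≤?_;
         ≤-refl; ≤-reflexive; ≤-trans; +-mono-≤; +-monoˡ-≤; +-monoʳ-≤;
         neg-antimono-≤; *-monoˡ-≤-nonNeg; +-identityʳ; module ≤-Reasoning)
open import Data.Rational.Solver using (module +-*-Solver)
open +-*-Solver using (solve; _:=_; _:+_; _:-_; _:*_; con)
import Data.Rational.Unnormalised as ℚᵘ
import Data.Rational.Unnormalised.Properties as ℚᵘ
open import Data.Product using (_,_)
open import Function using (case_of_)
open import Relation.Binary.PropositionalEquality using (_≡_; refl; sym; subst; subst₂)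
open import Relation.Nullary.Decidable using (True; yes; no; toWitness)

ℕtoℚ-mkℚ : ∀ n → ℕtoℚ n ≡ mkℚ (+ n) 0 (coprime-sym (1-coprimeTo n))
ℕtoℚ-mkℚ n = normalize-coprime (coprime-sym (1-coprimeTo n))

ℕtoℚ-suc : ∀ n → ℕtoℚ (suc n) ≡ ℕtoℚ n + 1ℚ
ℕtoℚ-suc n rewrite ℕtoℚ-mkℚ (suc n) | ℕtoℚ-mkℚ n =
  toℚᵘ-injective (ℚᵘ.≃-sym (ℚᵘ.≃-trans
    (toℚᵘ-homo-+ (mkℚ (+ n) 0 (coprime-sym (1-coprimeTo n))) 1ℚ)
    (ℚᵘ.*≡* (cross-multiplied (+ n)))))
  where
  cross-multiplied : ∀ x → (x ℤ.* + 1 ℤ.+ + 1 ℤ.* + 1) ℤ.* + 1 ≡ (+ 1 ℤ.+ x) ℤ.* + 1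
  cross-multiplied = solve-∀

inv-suc : ∀ n → inv (suc n) ≡ mkℚ (+ 1) n (1-coprimeTo (suc n))
inv-suc n = normalize-coprime (1-coprimeTo (suc n))

inv-antitone : ∀ {m n} → 1 ≤ m → m ≤ n → inv n ≤ℚ inv m
inv-antitone {suc m} {suc n} _ m≤n rewrite inv-suc m | inv-suc n =
  *≤* (subst₂ ℤ._≤_ (sym (ℤ.*-identityˡ _)) (sym (ℤ.*-identityˡ _)) (+≤+ m≤n))

inv-nonNeg : ∀ n → 0ℚ ≤ℚ inv n
inv-nonNeg zero    = ≤-refl
inv-nonNeg (suc n) rewrite inv-suc n = *≤* (+≤+ z≤n)

sum1to-mono : ∀ n {f g : ℕ → ℚ} → (∀ j → f j ≤ℚ g j) → sum1to n f ≤ℚ sum1to n g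
sum1to-mono zero    f≤g = ≤-refl
sum1to-mono (suc n) f≤g = +-mono-≤ (sum1to-mono n f≤g) (f≤g (suc n))

summand : ℕ → ℕ → ℚ
summand d j = ℕtoℚ 2 * inv (d ℕ.+ j) -ℚ inv d

-- lhs d k reduces to lhsWith k (summand d).
lhsWith : ℕ → (ℕ → ℚ) → ℚ
lhsWith k f = ((0ℚ -ℚ ℕtoℚ (k ∸ 1) * δ) + sum1to (k ∸ 1) f) + H (suc k)

lhsWith-mono : ∀ k {f g : ℕ → ℚ} → (∀ j → f j ≤ℚ g j) → lhsWith k f ≤ℚ lhsWith k g
lhsWith-mono k f≤g =
  +-monoˡ-≤ (H (suc k)) (+-monoʳ-≤ (0ℚ -ℚ ℕtoℚ (k ∸ 1) * δ) (sum1to-mono (k ∸ 1) f≤g))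

p-q≤p : ∀ p {q} → 0ℚ ≤ℚ q → p -ℚ q ≤ℚ p
p-q≤p p {q} 0≤q = ≤-trans (+-monoʳ-≤ p (neg-antimono-≤ 0≤q)) (≤-reflexive (+-identityʳ p))

≤-byComputation : ∀ {p q} {proof : True (p ≤? q)} → p ≤ℚ q
≤-byComputation {proof = proof} = toWitness proof

twice-mono : ∀ {p q} → p ≤ℚ q → ℕtoℚ 2 * p ≤ℚ ℕtoℚ 2 * q
twice-mono = *-monoˡ-≤-nonNeg (ℕtoℚ 2)

summand-≤-inv : ∀ {D d} j → 1 ≤ D → D ≤ d → summand d j ≤ℚ inv D
summand-≤-inv {D} {d} j 1≤D D≤d = begin
  ℕtoℚ 2 * inv (d ℕ.+ j) -ℚ inv d  ≤⟨ +-monoˡ-≤ (- inv d) (twice-mono (inv-antitone 1≤d (ℕ.m≤m+n d j))) ⟩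
  ℕtoℚ 2 * inv d -ℚ inv d          ≡⟨ twice-minus-once (inv d) ⟩
  inv d                            ≤⟨ inv-antitone 1≤D D≤d ⟩
  inv D                            ∎
  where
  open ≤-Reasoning
  1≤d = ℕ.≤-trans 1≤D D≤d
  twice-minus-once : ∀ r → ℕtoℚ 2 * r -ℚ r ≡ r
  twice-minus-once = solve 1 (λ r → con (ℕtoℚ 2) :* r :- r := r) refl

lhs-suc : ∀ d m → lhs d (2 ℕ.+ m) ≡ lhs d (1 ℕ.+ m) + (summand d (suc m) + (inv (3 ℕ.+ m) -ℚ δ))
lhs-suc d m rewrite ℕtoℚ-suc m =
  solve 6 (λ n δ′ s t h i →
      ((con 0ℚ :- (n :+ con 1ℚ) :* δ′) :+ (s :+ t)) :+ (h :+ i)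
        := (((con 0ℚ :- n :* δ′) :+ s) :+ h) :+ (t :+ (i :- δ′)))
    refl (ℕtoℚ m) δ (sum1to m (summand d)) (summand d (suc m)) (H (2 ℕ.+ m)) (inv (3 ℕ.+ m))

lhs-suc-≤ : ∀ {d m} → 2 ≤ d → 10 ≤ m → lhs d (2 ℕ.+ m) ≤ℚ lhs d (1 ℕ.+ m)
lhs-suc-≤ {d} {m} 2≤d 10≤m = begin
  lhs d (2 ℕ.+ m)                                             ≡⟨ lhs-suc d m ⟩
  lhs d (1 ℕ.+ m) + (summand d (suc m) + (inv (3 ℕ.+ m) -ℚ δ)) ≤⟨ +-monoʳ-≤ (lhs d (1 ℕ.+ m)) increment≤0 ⟩
  lhs d (1 ℕ.+ m) + 0ℚ                                        ≡⟨ +-identityʳ _ ⟩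
  lhs d (1 ℕ.+ m)                                             ∎
  where
  open ≤-Reasoning
  increment≤0 : summand d (suc m) + (inv (3 ℕ.+ m) -ℚ δ) ≤ℚ 0ℚ
  increment≤0 = begin
    summand d (suc m) + (inv (3 ℕ.+ m) -ℚ δ)
      ≤⟨ +-monoˡ-≤ (inv (3 ℕ.+ m) -ℚ δ) (p-q≤p (ℕtoℚ 2 * inv (d ℕ.+ suc m)) (inv-nonNeg d)) ⟩
    ℕtoℚ 2 * inv (d ℕ.+ suc m) + (inv (3 ℕ.+ m) -ℚ δ)
      ≤⟨ +-mono-≤ (twice-mono (inv-antitone (s≤s z≤n) (ℕ.+-mono-≤ 2≤d (s≤s 10≤m))))
                  (+-monoˡ-≤ (- δ) (inv-antitone (s≤s z≤n) (ℕ.+-monoʳ-≤ 3 10≤m))) ⟩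
    ℕtoℚ 2 * inv 13 + (inv 13 -ℚ δ)
      ≤⟨ ≤-byComputation ⟩  -- 3 · 420 < 13 · 97, barely
    0ℚ ∎

lhs-≤-lhs11 : ∀ {d} → 2 ≤ d → ∀ n → lhs d (11 ℕ.+ n) ≤ℚ lhs d 11
lhs-≤-lhs11 2≤d zero    = ≤-refl
lhs-≤-lhs11 2≤d (suc n) = ≤-trans (lhs-suc-≤ 2≤d (ℕ.m≤m+n 10 n)) (lhs-≤-lhs11 2≤d n)

lhs-bound-small-d : ∀ {k} → k < 11 → ∀ {e} → e < 10 →
  lhs (suc (suc e)) (suc k) ≤ℚ φ -ℚ β (suc k)
lhs-bound-small-d = toWitness {a? = ℕ.allUpTo? (λ k → ℕ.allUpTo? (λ e →
  lhs (suc (suc e)) (suc k) ≤? φ -ℚ β (suc k)) 10) 11} _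

lhsWith-inv12-bound : ∀ {k} → k < 11 → lhsWith (suc k) (λ _ → inv 12) ≤ℚ φ -ℚ β (suc k)
lhsWith-inv12-bound = toWitness {a? = ℕ.allUpTo? (λ k →
  lhsWith (suc k) (λ _ → inv 12) ≤? φ -ℚ β (suc k)) 11} _

-- `case` instead of `with`, and implicits given explicitly: abstracting over or
-- unifying with an lhs goal makes Agda normalise rational arithmetic, which is very slow.
lhs-bound-small-k : ∀ {d k} → 2 ≤ d → 1 ≤ k → k ≤ 11 → lhs d k ≤ℚ φ -ℚ β k
lhs-bound-small-k {suc zero}     (s≤s ())
lhs-bound-small-k {suc (suc e)} {suc k} _ _ k<11 = case e ℕ.<? 10 of λ where
  (yes e<10) → lhs-bound-small-d {k} k<11 {e} e<10
  (no e≮10)  → ≤-trans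
    (lhsWith-mono (suc k) (λ j → summand-≤-inv j (s≤s z≤n) (s≤s (s≤s (ℕ.≮⇒≥ e≮10)))))
    (lhsWith-inv12-bound {k} k<11)

lhs-bound-large-k : ∀ {d k} → 2 ≤ d → 11 ≤ k → lhs d k ≤ℚ φ -ℚ β k
lhs-bound-large-k {d} 2≤d 11≤k =
  let n , 11+n≡k = ℕ.m≤n⇒∃[o]m+o≡n 11≤k in
  subst (λ k → lhs d k ≤ℚ φ -ℚ β k) 11+n≡k
    (≤-trans (lhs-≤-lhs11 2≤d n) (lhs-bound-small-k {d} {11} 2≤d (s≤s z≤n) ℕ.≤-refl))

mainTheorem3 : (k₁ k d : ℕ) → 1 ≤ k₁ → k₁ ≤ k → 2 ≤ d →
    lhs d k ≤ℚ (φ -ℚ β k)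
mainTheorem3 k₁ k d 1≤k₁ k₁≤k 2≤d = case k ℕ.≤? 11 of λ where
  (yes k≤11) → lhs-bound-small-k {d} {k} 2≤d (ℕ.≤-trans 1≤k₁ k₁≤k) k≤11
  (no k≰11)  → lhs-bound-large-k {d} {k} 2≤d (ℕ.≰⇒≥ k≰11)
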